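{- For every set $A$, the presheaf $\mathsf{NV}(A)$ on $\mathbb{S}\mathsf{ur}$ is an atomic sheaf.
   Context: $\mathbb{S}\mathsf{ur}$ is the category of nonempty finite sets and surjections. $\mathsf{NV}(A)\colon\mathbb{S}\mathsf{ur}^{op}\to\mathbf{Set}$ sends $\Omega$ to the set of all functions $\Omega\to A$, and for a surjection $p\colon\Omega'\to\Omega$ sends $X$ to $X\cdot p := X\circ p$. A presheaf $P$ (with $x\cdot f := P(f)(x)$) is an atomic sheaf if for every morphism $c\colon Y\to X$, every $y\in P(Y)$ such that $y\cdot d = y\cdot e$ for all parallel $d,e\colon Z\to Y$ with $c\circ d = c\circ e$, has a unique $x\in P(X)$ with $y = x\cdot c$. -}

module Defs where

open import Level using (0ℓ)
open import Data.Nat using (ℕ; suc)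
open import Data.Fin using (Fin)
open import Data.Product using (Σ; ∃; _×_; _,_; proj₁; proj₂)
open import Relation.Binary.PropositionalEquality using (_≡_; refl; sym; trans; cong; isEquivalence)
open import Relation.Binary.Bundles using (Setoid)
open import Relation.Binary.Structures using (IsEquivalence)

-- We use the skeleton: object n : ℕ stands for the nonempty finite set
-- Obj n = Fin (suc n) (every nonempty finite set is isomorphic to one).

Obj : ℕ → Set
Obj n = Fin (suc n)

IsSurjection : ∀ {m n} → (Obj m → Obj n) → Set
IsSurjection {m} f = ∀ y → ∃ λ (x : Obj m) → f x ≡ y

record Sur (m n : ℕ) : Set where
  constructor sur
  field
    fun  : Obj m → Obj n
    surj : IsSurjection fun
open Sur public

_≈S_ : ∀ {m n} → Sur m n → Sur m n → Set
f ≈S g = ∀ x → fun f x ≡ fun g x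

idS : ∀ {n} → Sur n n
idS = sur (λ x → x) (λ y → y , refl)

_∘S_ : ∀ {m n k} → Sur n k → Sur m n → Sur m k
g ∘S f = sur (λ x → fun g (fun f x)) surj-comp
  where
  surj-comp : ∀ z → ∃ λ x → fun g (fun f x) ≡ z
  surj-comp z with surj g z
  ... | y , gy≡z with surj f y
  ...   | x , fx≡y = x , trans (cong (fun g) fx≡y) gy≡z

-- Presheaves on Sur (Set-valued; since Agda lacks function
-- extensionality, the value sets carry their equality as setoids).
-- Notation: act x f  is  x · f := P(f)(x).

record Presheaf : Set₁ where
  field
    P        : ℕ → Setoid 0ℓ 0ℓ
    act      : ∀ {m n} → Setoid.Carrier (P n) → Sur m n → Setoid.Carrier (P m)
    act-cong : ∀ {m n} {x x' : Setoid.Carrier (P n)} {f g : Sur m n} →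
               Setoid._≈_ (P n) x x' → f ≈S g →
               Setoid._≈_ (P m) (act x f) (act x' g)
    act-id   : ∀ {n} (x : Setoid.Carrier (P n)) → Setoid._≈_ (P n) (act x idS) x
    act-∘    : ∀ {m n k} (x : Setoid.Carrier (P k)) (g : Sur n k) (f : Sur m n) →
               Setoid._≈_ (P m) (act x (g ∘S f)) (act (act x g) f)

IsAtomicSheaf : Presheaf → Set
IsAtomicSheaf F =
  ∀ {Y X : ℕ} (c : Sur Y X) (y : Carrier (P Y)) →
  (∀ {Z : ℕ} (d e : Sur Z Y) → (c ∘S d) ≈S (c ∘S e) →
     Setoid._≈_ (P Z) (act y d) (act y e)) →
  Σ (Carrier (P X)) λ x →
     Setoid._≈_ (P Y) y (act x c) ×
     (∀ (x' : Carrier (P X)) → Setoid._≈_ (P Y) y (act x' c) → Setoid._≈_ (P X) x' x)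
  where open Presheaf F
        open Setoid using (Carrier)

FunSetoid : ℕ → Set → Setoid 0ℓ 0ℓ
FunSetoid n A = record
  { Carrier = Obj n → A
  ; _≈_ = λ X X' → ∀ i → X i ≡ X' i
  ; isEquivalence = record
      { refl = λ _ → refl
      ; sym = λ p i → sym (p i)
      ; trans = λ p q i → trans (p i) (q i) } }

NV : Set → Presheaf
NV A = record
  { P        = λ n → FunSetoid n A
  ; act      = λ X p i → X (fun p i)
  ; act-cong = λ {_} {_} {X} {X'} {f} {g} XX' fg i → trans (cong X (fg i)) (XX' (fun g i))
  ; act-id   = λ X i → refl
  ; act-∘    = λ X g f i → refl
  }

-- A family y : Ω_Y → A compatible with c is constant on the fibres of c:
-- if c i = c j, the two surjections Ω_Y + 1 → Ω_Y that double i resp. j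
-- become equal after c, so compatibility forces y i = y j. Hence y descends
-- along any section of c, and the descent is unique because c is surjective.
module Submission where

open import Defs
open import Data.Nat using (ℕ; suc)
open import Data.Fin using (zero; suc)
open import Data.Product using (_,_; proj₁; proj₂)
open import Relation.Binary.PropositionalEquality using (_≡_; refl; sym; trans; cong; module ≡-Reasoning)

Compatible : ∀ {A : Set} {Y X : ℕ} → Sur Y X → (Obj Y → A) → Set
Compatible {Y = Y} c y =
  ∀ {Z : ℕ} (d e : Sur Z Y) → (c ∘S d) ≈S (c ∘S e) → ∀ k → y (fun d k) ≡ y (fun e k)

duplicate : ∀ {n} → Obj n → Sur (suc n) n
duplicate {n} i = sur double (λ j → suc j , refl)
  where
  double : Obj (suc n) → Obj n
  double zero    = i
  double (suc j) = j

∘-duplicate-cong : ∀ {m n} (c : Sur m n) {i j : Obj m} →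
                   fun c i ≡ fun c j → (c ∘S duplicate i) ≈S (c ∘S duplicate j)
∘-duplicate-cong c ci≡cj zero    = ci≡cj
∘-duplicate-cong c ci≡cj (suc k) = refl

compatible⇒constant-on-fibres : ∀ {A : Set} {Y X : ℕ} (c : Sur Y X) {y : Obj Y → A} →
                                Compatible c y → ∀ {i j} → fun c i ≡ fun c j → y i ≡ y j
compatible⇒constant-on-fibres c compat {i} {j} ci≡cj =
  compat (duplicate i) (duplicate j) (∘-duplicate-cong c ci≡cj) zero

section : ∀ {m n} → Sur m n → Obj n → Obj m
section c j = proj₁ (surj c j)

section-inverseʳ : ∀ {m n} (c : Sur m n) (j : Obj n) → fun c (section c j) ≡ j
section-inverseʳ c j = proj₂ (surj c j)

∘-cancelʳ : ∀ {A : Set} {m n} (c : Sur m n) {x x' : Obj n → A} →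
            (∀ i → x (fun c i) ≡ x' (fun c i)) → ∀ j → x j ≡ x' j
∘-cancelʳ c {x} {x'} eq j = begin
  x j                       ≡⟨ cong x (sym (section-inverseʳ c j)) ⟩
  x (fun c (section c j))   ≡⟨ eq (section c j) ⟩
  x' (fun c (section c j))  ≡⟨ cong x' (section-inverseʳ c j) ⟩
  x' j                      ∎
  where open ≡-Reasoning

proposition3p10 : (A : Set) → IsAtomicSheaf (NV A)
proposition3p10 A {Y} {X} c y compat = descent , y≡descent∘c , unique
  where
  descent : Obj X → A
  descent j = y (section c j)

  y≡descent∘c : ∀ i → y i ≡ descent (fun c i)
  y≡descent∘c i = compatible⇒constant-on-fibres c compat
                    (sym (section-inverseʳ c (fun c i)))

  unique : ∀ x' → (∀ i → y i ≡ x' (fun c i)) → ∀ j → x' j ≡ descent j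
  unique x' y≡x'∘c = ∘-cancelʳ c (λ i → trans (sym (y≡x'∘c i)) (y≡descent∘c i))
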